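{- Let $m,n$ be positive integers. For a rational Dyck path $p$ of type $(m,n)$, let $a(p)$ denote the number of vertices of $p$, other than the origin $(0,0)$, that lie on the line $ny-mx=0$. Then \[ \sum_{p} \frac{\gcd(m,n)}{a(p)} \;=\; \frac{\gcd(m,n)}{m+n}\binom{m+n}{n}, \] where the sum runs over all rational Dyck paths $p$ of type $(m,n)$.
   Context: A rational Dyck path of type $(m,n)$ (on an $m\times n$ grid with $m$ rows and $n$ columns) is a lattice path from $(0,0)$ to $(n,m)$ consisting of $m$ unit up steps $(0,1)$ and $n$ unit right steps $(1,0)$ that never goes strictly below the line $ny-mx=0$ (i.e. every vertex $(x,y)$ satisfies $ny-mx\ge 0$). Vertices of the path on the line $ny-mx=0$ are called anchors; $a(p)\ge 1$ since the endpoint $(n,m)$ is an anchor. The quantity $\gcd(m,n)/a(p)$ is called the anchored weight of $p$, and $C^{gen}_{m,n}=\frac{\gcd(m,n)}{m+n}\binom{m+n}{n}$. -}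

module Defs where

open import Data.Bool using (Bool; true; false; if_then_else_)
open import Data.Nat using (ℕ; zero; suc; _+_; _*_; _≤ᵇ_; _≡ᵇ_)
open import Data.Nat.GCD using (gcd)
open import Data.Nat.Combinatorics using (_C_)
open import Data.List using (List; []; _∷_; map; _++_; filterᵇ; foldr)
open import Data.Integer using (+_)
open import Data.Rational using (ℚ; _/_; 0ℚ) renaming (_+_ to _+ℚ_)

-- A lattice path is a list of steps: true = up step (0,1), false = right step (1,0).
Path : Set
Path = List Bool

words : ℕ → ℕ → List Path
words zero    zero    = [] ∷ []
words zero    (suc n) = map (false ∷_) (words zero n)
words (suc m) zero    = map (true ∷_) (words m zero)
words (suc m) (suc n) = map (true ∷_) (words m (suc n)) ++ map (false ∷_) (words (suc m) n)

-- Walk the path from current vertex (x , y) on the m×n grid (m rows, n columns);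
-- checks that every vertex (x,y) visited after the start satisfies n*y ≥ m*x.
-- (The origin satisfies it trivially.)
aboveFrom : ℕ → ℕ → ℕ → ℕ → Path → Bool
aboveFrom m n x y []            = true
aboveFrom m n x y (true ∷ s)    = aboveFrom m n x (suc y) s
aboveFrom m n x y (false ∷ s)   =
  if (m * suc x) ≤ᵇ (n * y) then aboveFrom m n (suc x) y s else false

isDyck : ℕ → ℕ → Path → Bool
isDyck m n p = aboveFrom m n 0 0 p

dyckPaths : ℕ → ℕ → List Path
dyckPaths m n = filterᵇ (isDyck m n) (words m n)

anchorsFrom : ℕ → ℕ → ℕ → ℕ → Path → ℕ
anchorsFrom m n x y []          = 0
anchorsFrom m n x y (true ∷ s)  =
  (if (n * suc y) ≡ᵇ (m * x) then 1 else 0) + anchorsFrom m n x (suc y) s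
anchorsFrom m n x y (false ∷ s) =
  (if (n * y) ≡ᵇ (m * suc x) then 1 else 0) + anchorsFrom m n (suc x) y s

anchors : ℕ → ℕ → Path → ℕ
anchors m n p = anchorsFrom m n 0 0 p

-- gcd(m,n)/a ; a(p) ≥ 1 for every Dyck path, the zero case is never used.
anchoredWeightOf : ℕ → ℕ → ℚ
anchoredWeightOf g zero    = 0ℚ
anchoredWeightOf g (suc a) = (+ g) / suc a

anchoredWeight : ℕ → ℕ → Path → ℚ
anchoredWeight m n p = anchoredWeightOf (gcd m n) (anchors m n p)

sumℚ : List ℚ → ℚ
sumℚ = foldr _+ℚ_ 0ℚ

Cgen : ℕ → ℕ → ℚ
Cgen m n with m + n
... | zero  = 0ℚ
... | suc k = (+ (gcd m n * ((m + n) C n))) / suc k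

-- Let an up step raise the level by n and a right step lower it by m, so that the vertex
-- (x, y) of a path lies at level n·y − m·x. Every word w with m up and n right steps ends
-- at level 0, and rotating w cyclically at a vertex of level c permutes its list of vertex
-- levels cyclically and shifts it by −c. The rotation is therefore a Dyck path exactly when
-- c is the minimal level μ of w, and its anchors are then the vertices of w at level μ.
-- So exactly k of the m + n rotations of w are Dyck paths, where k is the number of vertices
-- at level μ, and each of them has weight gcd(m,n)/k: together the rotations of w contribute
-- gcd(m,n). Rotation permutes the words, so summing over all C(m+n,n) words gives
-- (m + n) · Σ_p gcd(m,n)/a(p) = gcd(m,n) · C(m+n,n).
module Submission where

open import Defs
open import Data.Nat using (ℕ; NonZero)
open import Data.List using (map)
open import Relation.Binary.PropositionalEquality using (_≡_)
open import Data.Nat using (zero; suc)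

open import Algebra.Bundles using (AbelianGroup; CommutativeMonoid)
import Algebra.Properties.CommutativeSemigroup as CommutativeSemigroupProperties
open import Data.Bool using (Bool; true; false; if_then_else_; _∧_)
open import Data.Integer using (ℤ; +_; 0ℤ; _+_; _-_; -_; _≤_; +≤+)
import Data.Integer as ℤ
import Data.Integer.Properties as ℤ
open import Data.Integer.Properties
  using (_≟_; _≤?_; ≤-totalOrder; ≤-antisym; ≤-trans; ≤-reflexive; i≤i+j; 0≤i-j⇒j≤i; i≤j⇒0≤j-i;
         i-j≡0⇒i≡j; +-injective; drop‿+≤+; +-identityˡ; +-identityʳ; +-assoc; +-comm; +-inverseʳ;
         pos-+; neg-distrib-+; +-0-abelianGroup; +-commutativeSemigroup)
open import Algebra.Properties.Group (AbelianGroup.group +-0-abelianGroup) using (inverseʳ-unique)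
open CommutativeSemigroupProperties +-commutativeSemigroup using (xy∙z≈xz∙y; xy∙z≈yz∙x; x∙yz≈xz∙y)
open import Data.List using (List; []; _∷_; _++_; _∷ʳ_; length; filter; iterate)
open import Data.List.Extrema ≤-totalOrder using (min; min≤⊤; min≤xs; v≤min⁺; argmin-sel)
open import Data.List.Membership.Propositional using (_∈_)
open import Data.List.Membership.Propositional.Properties using (∈-map⁺)
open import Data.List.Properties
  using (map-∘; map-++; map-cong-local; length-map; length-++; ++-assoc; ++-identityʳ; filter-some)
open import Data.List.Relation.Binary.Permutation.Propositional
  using (_↭_; module PermutationReasoning; ↭-refl; ↭-sym; ↭-trans; ↭-swap; ↭-reflexive; ↭⇒↭ₛ)
open import Data.List.Relation.Binary.Permutation.Propositional.Properties
  using (map⁺; ++⁺; ++-comm; ∷↭∷ʳ; drop-∷; All-resp-↭; filter-↭; ↭-length; ++-commutativeMonoid)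
open import Data.List.Relation.Binary.Permutation.Setoid.Properties using (foldr-commMonoid)
open import Data.List.Relation.Unary.All as All using (All; []; _∷_; all?)
import Data.List.Relation.Unary.All.Properties as All
open import Data.List.Relation.Unary.Any using (here; there)
import Data.Nat as ℕ
import Data.Nat.Properties as ℕ
open import Data.Nat.Combinatorics using (_C_; nCn≡1; nCk+nC[k+1]≡[n+1]C[k+1])
open import Data.Nat.GCD using (gcd)
open import Data.Product using (_×_; _,_)
open import Data.Rational using (ℚ; _/_; 0ℚ; 1ℚ; 1/_; toℚᵘ)
import Data.Rational as ℚ
import Data.Rational.Properties as ℚ
open import Data.Rational.Unnormalised using (mkℚᵘ; *≡*) renaming (_≃_ to _≃ᵘ_)
import Data.Rational.Unnormalised as ℚᵘ
import Data.Rational.Unnormalised.Properties as ℚᵘ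
open import Data.Sum using ([_,_]′)
open import Function using (_∘′_; mk⇔)
open import Level using (0ℓ)
open import Relation.Binary.PropositionalEquality
  using (refl; sym; trans; cong; cong₂; subst; setoid; module ≡-Reasoning)
open import Relation.Nullary using (Dec; does; yes; no; ¬_)
open import Relation.Nullary.Decidable using (does-⇔; dec-true; dec-false)
open import Relation.Unary using (Pred; Decidable)

open CommutativeSemigroupProperties (CommutativeMonoid.commutativeSemigroup ℚ.+-0-commutativeMonoid)
  using () renaming (interchange to +-interchange)
open CommutativeSemigroupProperties (CommutativeMonoid.commutativeSemigroup (++-commutativeMonoid {A = Path}))
  using () renaming (interchange to ++-interchange)

private variable
  A : Set
  xs ys : List A

-- Natural numbers as rationals

fromℕ : ℕ → ℚ
fromℕ k = + k / 1

toℚᵘ-/ : ∀ i d → toℚᵘ (i / suc d) ≃ᵘ mkℚᵘ i d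
toℚᵘ-/ i d = ℚ.toℚᵘ-fromℚᵘ (mkℚᵘ i d)

fromℕ-+ : ∀ a b → fromℕ (a ℕ.+ b) ≡ fromℕ a ℚ.+ fromℕ b
fromℕ-+ a b = ℚ.toℚᵘ-injective (begin
  toℚᵘ (fromℕ (a ℕ.+ b))                  ≈⟨ toℚᵘ-/ (+ (a ℕ.+ b)) 0 ⟩
  mkℚᵘ (+ (a ℕ.+ b)) 0                    ≈⟨ *≡* (cong (ℤ._* + 1) numerators) ⟩
  mkℚᵘ (+ a) 0 ℚᵘ.+ mkℚᵘ (+ b) 0          ≈⟨ ℚᵘ.+-cong (toℚᵘ-/ (+ a) 0) (toℚᵘ-/ (+ b) 0) ⟨
  toℚᵘ (fromℕ a) ℚᵘ.+ toℚᵘ (fromℕ b)      ≈⟨ ℚ.toℚᵘ-homo-+ (fromℕ a) (fromℕ b) ⟨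
  toℚᵘ (fromℕ a ℚ.+ fromℕ b)              ∎)
  where
  open ℚᵘ.≃-Reasoning
  numerators : + (a ℕ.+ b) ≡ + a ℤ.* + 1 + + b ℤ.* + 1
  numerators = trans (pos-+ a b) (sym (cong₂ _+_ (ℤ.*-identityʳ (+ a)) (ℤ.*-identityʳ (+ b))))

fromℕ-* : ∀ a b → fromℕ (a ℕ.* b) ≡ fromℕ a ℚ.* fromℕ b
fromℕ-* a b = ℚ.toℚᵘ-injective (begin
  toℚᵘ (fromℕ (a ℕ.* b))                  ≈⟨ toℚᵘ-/ (+ (a ℕ.* b)) 0 ⟩
  mkℚᵘ (+ (a ℕ.* b)) 0                    ≈⟨ *≡* (cong (ℤ._* + 1) (ℤ.pos-* a b)) ⟩
  mkℚᵘ (+ a) 0 ℚᵘ.* mkℚᵘ (+ b) 0          ≈⟨ ℚᵘ.*-cong (toℚᵘ-/ (+ a) 0) (toℚᵘ-/ (+ b) 0) ⟨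
  toℚᵘ (fromℕ a) ℚᵘ.* toℚᵘ (fromℕ b)      ≈⟨ ℚ.toℚᵘ-homo-* (fromℕ a) (fromℕ b) ⟨
  toℚᵘ (fromℕ a ℚ.* fromℕ b)              ∎)
  where open ℚᵘ.≃-Reasoning

fromℕ-*-/ : ∀ k g .{{_ : NonZero k}} → fromℕ k ℚ.* (+ g / k) ≡ fromℕ g
fromℕ-*-/ (suc d) g = ℚ.toℚᵘ-injective (begin
  toℚᵘ (fromℕ (suc d) ℚ.* (+ g / suc d))           ≈⟨ ℚ.toℚᵘ-homo-* (fromℕ (suc d)) (+ g / suc d) ⟩
  toℚᵘ (fromℕ (suc d)) ℚᵘ.* toℚᵘ (+ g / suc d)     ≈⟨ ℚᵘ.*-cong (toℚᵘ-/ (+ suc d) 0) (toℚᵘ-/ (+ g) d) ⟩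
  mkℚᵘ (+ suc d) 0 ℚᵘ.* mkℚᵘ (+ g) d               ≈⟨ *≡* cross-multiplied ⟩
  mkℚᵘ (+ g) 0                                     ≈⟨ toℚᵘ-/ (+ g) 0 ⟨
  toℚᵘ (fromℕ g)                                   ∎)
  where
  open ℚᵘ.≃-Reasoning
  cross-multiplied : (+ suc d ℤ.* + g) ℤ.* + 1 ≡ + g ℤ.* (+ 1 ℤ.* + suc d)
  cross-multiplied = trans (ℤ.*-identityʳ _)
    (trans (ℤ.*-comm (+ suc d) (+ g)) (cong (+ g ℤ.*_) (sym (ℤ.*-identityˡ (+ suc d)))))

fromℕ-suc-* : ∀ k q → fromℕ (suc k) ℚ.* q ≡ q ℚ.+ fromℕ k ℚ.* q
fromℕ-suc-* k q = trans (cong (ℚ._* q) (fromℕ-+ 1 k))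
  (trans (ℚ.*-distribʳ-+ q 1ℚ (fromℕ k)) (cong (ℚ._+ fromℕ k ℚ.* q) (ℚ.*-identityˡ q)))

*-cancelˡ-≡ : ∀ r .{{_ : ℚ.NonZero r}} {p q} → r ℚ.* p ≡ r ℚ.* q → p ≡ q
*-cancelˡ-≡ r {p} {q} rp≡rq = begin
  p                    ≡⟨ ℚ.*-identityˡ p ⟨
  1ℚ ℚ.* p             ≡⟨ cong (ℚ._* p) (ℚ.*-inverseˡ r) ⟨
  (1/ r ℚ.* r) ℚ.* p   ≡⟨ ℚ.*-assoc (1/ r) r p ⟩
  1/ r ℚ.* (r ℚ.* p)   ≡⟨ cong (1/ r ℚ.*_) rp≡rq ⟩
  1/ r ℚ.* (r ℚ.* q)   ≡⟨ ℚ.*-assoc (1/ r) r q ⟨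
  (1/ r ℚ.* r) ℚ.* q   ≡⟨ cong (ℚ._* q) (ℚ.*-inverseˡ r) ⟩
  1ℚ ℚ.* q             ≡⟨ ℚ.*-identityˡ q ⟩
  q                    ∎
  where open ≡-Reasoning

k*q≡g⇒q≡g/k : ∀ k .{{_ : NonZero k}} {q} g → fromℕ k ℚ.* q ≡ fromℕ g → q ≡ + g / k
k*q≡g⇒q≡g/k k@(suc _) g k*q≡g = *-cancelˡ-≡ (fromℕ k) {{k≢0}} (trans k*q≡g (sym (fromℕ-*-/ k g)))
  where k≢0 = ℚ.pos⇒nonZero (fromℕ k) {{ℚ.normalize-pos k 1}}

-- Sums of rationals

sumℚ-↭ : xs ↭ ys → sumℚ xs ≡ sumℚ ys
sumℚ-↭ xs↭ys = foldr-commMonoid (setoid ℚ) ℚ.+-0-isCommutativeMonoid (↭⇒↭ₛ xs↭ys)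

sumℚ-map-+ : ∀ (f g : A → ℚ) xs →
             sumℚ (map (λ x → f x ℚ.+ g x) xs) ≡ sumℚ (map f xs) ℚ.+ sumℚ (map g xs)
sumℚ-map-+ f g []       = sym (ℚ.+-identityˡ 0ℚ)
sumℚ-map-+ f g (x ∷ xs) = trans (cong (f x ℚ.+ g x ℚ.+_) (sumℚ-map-+ f g xs))
  (+-interchange (f x) (g x) (sumℚ (map f xs)) (sumℚ (map g xs)))

sumℚ-const : ∀ c (xs : List A) → sumℚ (map (λ _ → c) xs) ≡ fromℕ (length xs) ℚ.* c
sumℚ-const c []       = sym (ℚ.*-zeroˡ c)
sumℚ-const c (x ∷ xs) = trans (cong (c ℚ.+_) (sumℚ-const c xs)) (sym (fromℕ-suc-* (length xs) c))

sumℚ-filter : ∀ {P : Pred A 0ℓ} (P? : Decidable P) (f : A → ℚ) xs →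
              sumℚ (map f (filter P? xs)) ≡ sumℚ (map (λ x → if does (P? x) then f x else 0ℚ) xs)
sumℚ-filter P? f []       = refl
sumℚ-filter P? f (x ∷ xs) with does (P? x)
... | true  = cong (f x ℚ.+_) (sumℚ-filter P? f xs)
... | false = trans (sumℚ-filter P? f xs) (sym (ℚ.+-identityˡ _))

sumℚ-orbits : ∀ {A : Set} (f : A → A) (φ : A → ℚ) {xs} → map f xs ↭ xs → ∀ L →
              sumℚ (map (λ x → sumℚ (map φ (iterate f x L))) xs) ≡ fromℕ L ℚ.* sumℚ (map φ xs)
sumℚ-orbits f φ {xs} _ zero =
  trans (sumℚ-const 0ℚ xs) (trans (ℚ.*-zeroʳ (fromℕ (length xs))) (sym (ℚ.*-zeroˡ (sumℚ (map φ xs)))))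
sumℚ-orbits {A} f φ {xs} fxs↭xs (suc L) = begin
  sumℚ (map (λ x → φ x ℚ.+ orbitSum (f x)) xs)     ≡⟨ sumℚ-map-+ φ (orbitSum ∘′ f) xs ⟩
  Σφ ℚ.+ sumℚ (map (orbitSum ∘′ f) xs)             ≡⟨ cong (λ ys → Σφ ℚ.+ sumℚ ys) (map-∘ xs) ⟩
  Σφ ℚ.+ sumℚ (map orbitSum (map f xs))            ≡⟨ cong (Σφ ℚ.+_) (sumℚ-↭ (map⁺ orbitSum fxs↭xs)) ⟩
  Σφ ℚ.+ sumℚ (map orbitSum xs)                    ≡⟨ cong (Σφ ℚ.+_) (sumℚ-orbits f φ fxs↭xs L) ⟩
  Σφ ℚ.+ fromℕ L ℚ.* Σφ                            ≡⟨ fromℕ-suc-* L Σφ ⟨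
  fromℕ (suc L) ℚ.* Σφ                             ∎
  where
  open ≡-Reasoning
  Σφ = sumℚ (map φ xs)
  orbitSum : A → ℚ
  orbitSum x = sumℚ (map φ (iterate f x L))

-- Rotations of words

rotate₁ : List A → List A
rotate₁ []       = []
rotate₁ (x ∷ xs) = xs ∷ʳ x

prefix suffix : Bool → List Path → List Path
prefix b = map (b ∷_)
suffix b = map (_∷ʳ b)

prefix-suffix : ∀ b c ws → prefix b (suffix c ws) ≡ suffix c (prefix b ws)
prefix-suffix b c ws = trans (sym (map-∘ ws)) (map-∘ ws)

prefix-suffix-interchange : ∀ ws xs ys zs →
  prefix true (suffix true ws ++ suffix false xs) ++ prefix false (suffix true ys ++ suffix false zs)
  ↭ suffix true (prefix true ws ++ prefix false ys) ++ suffix false (prefix true xs ++ prefix false zs)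
prefix-suffix-interchange ws xs ys zs = begin
  prefix true (suffix true ws ++ suffix false xs) ++ prefix false (suffix true ys ++ suffix false zs)
    ≡⟨ cong₂ _++_ (map-++ _ (suffix true ws) _) (map-++ _ (suffix true ys) _) ⟩
  (prefix true (suffix true ws) ++ prefix true (suffix false xs)) ++
  (prefix false (suffix true ys) ++ prefix false (suffix false zs))
    ↭⟨ ++-interchange (prefix true (suffix true ws)) _ _ _ ⟩
  (prefix true (suffix true ws) ++ prefix false (suffix true ys)) ++
  (prefix true (suffix false xs) ++ prefix false (suffix false zs))
    ≡⟨ cong₂ _++_ (cong₂ _++_ (prefix-suffix true true ws) (prefix-suffix false true ys))
                  (cong₂ _++_ (prefix-suffix true false xs) (prefix-suffix false false zs)) ⟩
  (suffix true (prefix true ws) ++ suffix true (prefix false ys)) ++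
  (suffix false (prefix true xs) ++ suffix false (prefix false zs))
    ≡⟨ cong₂ _++_ (map-++ _ (prefix true ws) _) (map-++ _ (prefix true xs) _) ⟨
  suffix true (prefix true ws ++ prefix false ys) ++ suffix false (prefix true xs ++ prefix false zs) ∎
  where open PermutationReasoning

words-zero-∷ʳ : ∀ b → words 0 (suc b) ≡ suffix false (words 0 b)
words-zero-∷ʳ zero    = refl
words-zero-∷ʳ (suc b) = trans (cong (prefix false) (words-zero-∷ʳ b)) (prefix-suffix false false (words 0 b))

words-∷ʳ-zero : ∀ a → words (suc a) 0 ≡ suffix true (words a 0)
words-∷ʳ-zero zero    = refl
words-∷ʳ-zero (suc a) = trans (cong (prefix true) (words-∷ʳ-zero a)) (prefix-suffix true true (words a 0))

words-∷ʳ : ∀ a b → words (suc a) (suc b) ↭ suffix true (words a (suc b)) ++ suffix false (words (suc a) b)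
words-∷ʳ zero    zero    = ↭-swap _ _ ↭-refl
words-∷ʳ zero    (suc b) = ↭-trans
  (++⁺ (↭-reflexive (cong (prefix true) (words-zero-∷ʳ (suc b)))) (map⁺ _ (words-∷ʳ zero b)))
  (prefix-suffix-interchange [] (words 0 (suc b)) (words 0 (suc b)) (words 1 b))
words-∷ʳ (suc a) zero    = ↭-trans
  (++⁺ (map⁺ _ (words-∷ʳ a zero))
       (↭-reflexive (cong (prefix false) (trans (words-∷ʳ-zero (suc a)) (sym (++-identityʳ _))))))
  (↭-trans (prefix-suffix-interchange (words a 1) (words (suc a) 0) (words (suc a) 0) [])
           (↭-reflexive (cong (λ ws → suffix true (words (suc a) 1) ++ suffix false ws) (++-identityʳ _))))
words-∷ʳ (suc a) (suc b) = ↭-trans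
  (++⁺ (map⁺ _ (words-∷ʳ a (suc b))) (map⁺ _ (words-∷ʳ (suc a) b)))
  (prefix-suffix-interchange (words a (suc (suc b))) (words (suc a) (suc b))
                             (words (suc a) (suc b)) (words (suc (suc a)) b))

map-rotate₁-words : ∀ a b → map rotate₁ (words a b) ↭ words a b
map-rotate₁-words zero    zero    = ↭-refl
map-rotate₁-words zero    (suc b) = ↭-reflexive (trans (sym (map-∘ (words 0 b))) (sym (words-zero-∷ʳ b)))
map-rotate₁-words (suc a) zero    = ↭-reflexive (trans (sym (map-∘ (words a 0))) (sym (words-∷ʳ-zero a)))
map-rotate₁-words (suc a) (suc b) = ↭-trans
  (↭-reflexive (trans (map-++ rotate₁ (prefix true (words a (suc b))) _)
                      (sym (cong₂ _++_ (map-∘ (words a (suc b))) (map-∘ (words (suc a) b))))))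
  (↭-sym (words-∷ʳ a b))

length-words : ∀ a b → length (words a b) ≡ (a ℕ.+ b) C b
length-words zero    zero    = refl
length-words zero    (suc b) =
  trans (length-map _ (words 0 b)) (trans (length-words 0 b) (trans (nCn≡1 b) (sym (nCn≡1 (suc b)))))
length-words (suc a) zero    = trans (length-map _ (words a 0)) (length-words a 0)
length-words (suc a) (suc b) = begin
  length (prefix true (words a (suc b)) ++ prefix false (words (suc a) b))
    ≡⟨ length-++ (prefix true (words a (suc b))) ⟩
  length (prefix true (words a (suc b))) ℕ.+ length (prefix false (words (suc a) b))
    ≡⟨ cong₂ ℕ._+_ (length-map _ (words a (suc b))) (length-map _ (words (suc a) b)) ⟩
  length (words a (suc b)) ℕ.+ length (words (suc a) b)
    ≡⟨ cong₂ ℕ._+_ (length-words a (suc b))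
                   (trans (length-words (suc a) b) (cong (_C b) (sym (ℕ.+-suc a b)))) ⟩
  (a ℕ.+ suc b) C suc b ℕ.+ (a ℕ.+ suc b) C b
    ≡⟨ ℕ.+-comm ((a ℕ.+ suc b) C suc b) _ ⟩
  (a ℕ.+ suc b) C b ℕ.+ (a ℕ.+ suc b) C suc b
    ≡⟨ nCk+nC[k+1]≡[n+1]C[k+1] (a ℕ.+ suc b) b ⟩
  suc (a ℕ.+ suc b) C suc b ∎
  where open ≡-Reasoning

words-All : ∀ (P : ℕ → ℕ → Path → Set) → P 0 0 [] →
            (∀ {a b w} → P a b w → P (suc a) b (true ∷ w)) →
            (∀ {a b w} → P a b w → P a (suc b) (false ∷ w)) →
            ∀ a b → All (P a b) (words a b)
words-All P P₀ up right = go
  where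
  go : ∀ a b → All (P a b) (words a b)
  go zero    zero    = P₀ ∷ []
  go zero    (suc b) = All.map⁺ (All.map right (go zero b))
  go (suc a) zero    = All.map⁺ (All.map up (go a zero))
  go (suc a) (suc b) = All.++⁺ (All.map⁺ (All.map up (go a (suc b)))) (All.map⁺ (All.map right (go (suc a) b)))

-- Level profiles

#zeros : List ℤ → ℕ
#zeros hs = length (filter (0ℤ ≟_) hs)

module _ (g : ℕ) where

  -- The anchored weight of a path whose vertices after the origin lie at the levels hs.
  profileWeight : List ℤ → ℚ
  profileWeight hs = if does (all? (0ℤ ≤?_) hs) then anchoredWeightOf g (#zeros hs) else 0ℚ

  profileWeight-↭ : ∀ {hs hs′} → hs ↭ hs′ → profileWeight hs ≡ profileWeight hs′
  profileWeight-↭ hs↭hs′ = cong₂ (λ b a → if b then anchoredWeightOf g a else 0ℚ)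
    (does-⇔ (mk⇔ (All-resp-↭ hs↭hs′) (All-resp-↭ (↭-sym hs↭hs′))) (all? (0ℤ ≤?_) _) (all? (0ℤ ≤?_) _))
    (↭-length (filter-↭ (0ℤ ≟_) hs↭hs′))

  profileWeight-nonNeg : ∀ {hs} → All (0ℤ ≤_) hs → profileWeight hs ≡ anchoredWeightOf g (#zeros hs)
  profileWeight-nonNeg {hs} nonNeg =
    cong (λ b → if b then anchoredWeightOf g (#zeros hs) else 0ℚ) (dec-true (all? (0ℤ ≤?_) hs) nonNeg)

  profileWeight-neg : ∀ {hs} → ¬ All (0ℤ ≤_) hs → profileWeight hs ≡ 0ℚ
  profileWeight-neg {hs} ¬nonNeg =
    cong (λ b → if b then anchoredWeightOf g (#zeros hs) else 0ℚ) (dec-false (all? (0ℤ ≤?_) hs) ¬nonNeg)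

  fromℕ-*-anchoredWeightOf : ∀ a → 0 ℕ.< a → fromℕ a ℚ.* anchoredWeightOf g a ≡ fromℕ g
  fromℕ-*-anchoredWeightOf (suc a) _ = fromℕ-*-/ (suc a) g

  -- Only the recentring at the minimum μ of H is nonnegative, and it has one zero per entry μ of H.
  sum-profileWeight-recentred : ∀ h hs → let H = h ∷ hs in
                                sumℚ (map (λ c → profileWeight (map (_- c) H)) H) ≡ fromℕ g
  sum-profileWeight-recentred h hs = begin
    sumℚ (map (λ c → profileWeight (map (_- c) H)) H)
      ≡⟨ cong sumℚ (map-cong-local (All.tabulate recentred-at)) ⟩
    sumℚ (map (λ c → if does (0ℤ ≟ c - μ) then K else 0ℚ) H)
      ≡⟨ cong sumℚ (map-∘ {g = zeroIndicator} {f = _- μ} H) ⟩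
    sumℚ (map zeroIndicator D)
      ≡⟨ sumℚ-filter (0ℤ ≟_) (λ _ → K) D ⟨
    sumℚ (map (λ _ → K) (filter (0ℤ ≟_) D))
      ≡⟨ sumℚ-const K (filter (0ℤ ≟_) D) ⟩
    fromℕ (#zeros D) ℚ.* K
      ≡⟨ cong (fromℕ (#zeros D) ℚ.*_) (profileWeight-nonNeg D-nonNeg) ⟩
    fromℕ (#zeros D) ℚ.* anchoredWeightOf g (#zeros D)
      ≡⟨ fromℕ-*-anchoredWeightOf (#zeros D) (filter-some (0ℤ ≟_) 0∈D) ⟩
    fromℕ g ∎
    where
    open ≡-Reasoning
    H = h ∷ hs
    μ = min h hs
    D = map (_- μ) H
    K = profileWeight D
    zeroIndicator : ℤ → ℚ
    zeroIndicator d = if does (0ℤ ≟ d) then K else 0ℚ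
    μ≤H : All (μ ≤_) H
    μ≤H = min≤⊤ h hs ∷ min≤xs h hs
    μ∈H : μ ∈ H
    μ∈H = [ here , there ]′ (argmin-sel (λ x → x) h hs)
    D-nonNeg : All (0ℤ ≤_) D
    D-nonNeg = All.map⁺ (All.map i≤j⇒0≤j-i μ≤H)
    0∈D : 0ℤ ∈ D
    0∈D = subst (_∈ D) (+-inverseʳ μ) (∈-map⁺ (_- μ) μ∈H)
    ≤μ : ∀ {c} → All (0ℤ ≤_) (map (_- c) H) → c ≤ μ
    ≤μ nonNeg with All.map 0≤i-j⇒j≤i (All.map⁻ nonNeg)
    ... | c≤h ∷ c≤hs = v≤min⁺ c≤h c≤hs
    recentred-at : ∀ {c} → c ∈ H → profileWeight (map (_- c) H) ≡ (if does (0ℤ ≟ c - μ) then K else 0ℚ)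
    recentred-at {c} c∈H with c ≟ μ
    ... | yes refl = cong (λ b → if b then K else 0ℚ) (sym (dec-true (0ℤ ≟ μ - μ) (sym (+-inverseʳ μ))))
    ... | no c≢μ   = trans
      (profileWeight-neg (λ nonNeg → c≢μ (≤-antisym (≤μ nonNeg) (All.lookup μ≤H c∈H))))
      (cong (λ b → if b then K else 0ℚ) (sym (dec-false (0ℤ ≟ c - μ) 0≢c-μ)))
      where
      0≢c-μ : ¬ 0ℤ ≡ c - μ
      0≢c-μ 0≡c-μ = c≢μ (i-j≡0⇒i≡j c μ (sym 0≡c-μ))

-- Lattice paths of type (m, n)

length-filter-∷ : ∀ {P : Pred A 0ℓ} (P? : Decidable P) x xs →
                  length (filter P? (x ∷ xs)) ≡ (if does (P? x) then 1 else 0) ℕ.+ length (filter P? xs)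
length-filter-∷ P? x xs with does (P? x)
... | true  = refl
... | false = refl

module _ (m n : ℕ) where

  step : Bool → ℤ
  step true  = + n
  step false = - + m

  level : Path → ℤ
  level []      = 0ℤ
  level (b ∷ s) = step b + level s

  heights : ℤ → Path → List ℤ
  heights c []      = []
  heights c (b ∷ s) = c + step b ∷ heights (c + step b) s

  startLevels : ℤ → Path → List ℤ
  startLevels c []      = []
  startLevels c (b ∷ s) = c ∷ startLevels (c + step b) s

  level-++ : ∀ s t → level (s ++ t) ≡ level s + level t
  level-++ []      t = sym (+-identityˡ (level t))
  level-++ (b ∷ s) t =
    trans (cong (_+_ (step b)) (level-++ s t)) (sym (+-assoc (step b) (level s) (level t)))

  heights-++ : ∀ c s t → heights c (s ++ t) ≡ heights c s ++ heights (c + level s) t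
  heights-++ c []      t = cong (λ d → heights d t) (sym (+-identityʳ c))
  heights-++ c (b ∷ s) t = cong (c + step b ∷_) (trans (heights-++ (c + step b) s t)
    (cong (λ d → heights (c + step b) s ++ heights d t) (+-assoc c (step b) (level s))))

  heights-+ : ∀ c d s → heights (c + d) s ≡ map (_+ d) (heights c s)
  heights-+ c d []      = refl
  heights-+ c d (b ∷ s) = cong₂ _∷_ (xy∙z≈xz∙y c d (step b))
    (trans (cong (λ e → heights e s) (xy∙z≈xz∙y c d (step b))) (heights-+ (c + step b) d s))

  heights-rotate : ∀ s t → level (s ++ t) ≡ 0ℤ →
                   heights 0ℤ (t ++ s) ↭ map (_- level s) (heights 0ℤ (s ++ t))
  heights-rotate s t level≡0 = begin
    heights 0ℤ (t ++ s)                                    ≡⟨ heights-++ 0ℤ t s ⟩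
    heights 0ℤ t ++ heights (0ℤ + level t) s               ≡⟨ cong₂ _++_ heights-t heights-s ⟩
    map (_- c) (heights c t) ++ map (_- c) (heights 0ℤ s)  ≡⟨ map-++ (_- c) (heights c t) (heights 0ℤ s) ⟨
    map (_- c) (heights c t ++ heights 0ℤ s)               ↭⟨ map⁺ (_- c) (++-comm (heights c t) (heights 0ℤ s)) ⟩
    map (_- c) (heights 0ℤ s ++ heights c t)               ≡⟨ cong (map (_- c)) (sym heights-st) ⟩
    map (_- c) (heights 0ℤ (s ++ t))                       ∎
    where
    open PermutationReasoning
    c = level s
    heights-t : heights 0ℤ t ≡ map (_- c) (heights c t)
    heights-t = trans (cong (λ d → heights d t) (sym (+-inverseʳ c))) (heights-+ c (- c) t)
    heights-s : heights (0ℤ + level t) s ≡ map (_- c) (heights 0ℤ s)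
    level-t : level t ≡ - c
    level-t = inverseʳ-unique c (level t) (trans (sym (level-++ s t)) level≡0)
    heights-s = trans (cong (λ d → heights (0ℤ + d) s) level-t) (heights-+ 0ℤ (- c) s)
    heights-st : heights 0ℤ (s ++ t) ≡ heights 0ℤ s ++ heights c t
    heights-st = trans (heights-++ 0ℤ s t) (cong (λ d → heights 0ℤ s ++ heights d t) (+-identityˡ c))

  startLevels-∷ʳ : ∀ c s → startLevels c s ∷ʳ (c + level s) ≡ c ∷ heights c s
  startLevels-∷ʳ c []      = cong (_∷ []) (+-identityʳ c)
  startLevels-∷ʳ c (b ∷ s) = cong (c ∷_) (trans
    (cong (startLevels (c + step b) s ∷ʳ_) (sym (+-assoc c (step b) (level s))))
    (startLevels-∷ʳ (c + step b) s))

  startLevels-↭ : ∀ s → level s ≡ 0ℤ → startLevels 0ℤ s ↭ heights 0ℤ s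
  startLevels-↭ s level≡0 = drop-∷ (begin
    0ℤ ∷ startLevels 0ℤ s
      ↭⟨ ∷↭∷ʳ 0ℤ (startLevels 0ℤ s) ⟩
    startLevels 0ℤ s ∷ʳ 0ℤ
      ≡⟨ cong (startLevels 0ℤ s ∷ʳ_) (trans (sym level≡0) (sym (+-identityˡ (level s)))) ⟩
    startLevels 0ℤ s ∷ʳ (0ℤ + level s)
      ≡⟨ startLevels-∷ʳ 0ℤ s ⟩
    0ℤ ∷ heights 0ℤ s ∎)
    where open PermutationReasoning

  height : ℕ → ℕ → ℤ
  height x y = + (n ℕ.* y) - + (m ℕ.* x)

  height-origin : height 0 0 ≡ 0ℤ
  height-origin = cong₂ (λ a b → + a - + b) (ℕ.*-zeroʳ n) (ℕ.*-zeroʳ m)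

  height-up : ∀ x y → height x (suc y) ≡ height x y + step true
  height-up x y = begin
    + (n ℕ.* suc y) - + (m ℕ.* x)        ≡⟨ cong (λ a → + a - + (m ℕ.* x)) (ℕ.*-suc n y) ⟩
    + (n ℕ.+ n ℕ.* y) - + (m ℕ.* x)      ≡⟨ cong (_- + (m ℕ.* x)) (pos-+ n (n ℕ.* y)) ⟩
    + n + + (n ℕ.* y) - + (m ℕ.* x)      ≡⟨ xy∙z≈yz∙x (+ n) (+ (n ℕ.* y)) (- + (m ℕ.* x)) ⟩
    height x y + + n                     ∎
    where open ≡-Reasoning

  height-right : ∀ x y → height (suc x) y ≡ height x y + step false
  height-right x y = begin
    + (n ℕ.* y) - + (m ℕ.* suc x)          ≡⟨ cong (λ a → + (n ℕ.* y) - + a) (ℕ.*-suc m x) ⟩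
    + (n ℕ.* y) - + (m ℕ.+ m ℕ.* x)        ≡⟨ cong (λ a → + (n ℕ.* y) - a) (pos-+ m (m ℕ.* x)) ⟩
    + (n ℕ.* y) + - (+ m + + (m ℕ.* x))    ≡⟨ cong (_+_ (+ (n ℕ.* y))) (neg-distrib-+ (+ m) (+ (m ℕ.* x))) ⟩
    + (n ℕ.* y) + (- + m + - + (m ℕ.* x))  ≡⟨ x∙yz≈xz∙y (+ (n ℕ.* y)) (- + m) (- + (m ℕ.* x)) ⟩
    height x y + - + m                     ∎
    where open ≡-Reasoning

  height-end : height n m ≡ 0ℤ
  height-end = trans (cong (λ a → + a - + (m ℕ.* n)) (ℕ.*-comm n m)) (+-inverseʳ (+ (m ℕ.* n)))

  does-0≤height : ∀ x y → does (0ℤ ≤? height x y) ≡ (m ℕ.* x ℕ.≤ᵇ n ℕ.* y)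
  does-0≤height x y = does-⇔
    (mk⇔ (λ 0≤h → drop‿+≤+ (0≤i-j⇒j≤i 0≤h)) (λ mx≤ny → i≤j⇒0≤j-i (+≤+ mx≤ny)))
    (0ℤ ≤? height x y) (m ℕ.* x ℕ.≤? n ℕ.* y)

  does-0≟height : ∀ x y → does (0ℤ ≟ height x y) ≡ (n ℕ.* y ℕ.≡ᵇ m ℕ.* x)
  does-0≟height x y = does-⇔
    (mk⇔ (λ 0≡h → +-injective (i-j≡0⇒i≡j _ _ (sym 0≡h)))
         (λ ny≡mx → sym (trans (cong (λ a → + a - + (m ℕ.* x)) ny≡mx) (+-inverseʳ (+ (m ℕ.* x))))))
    (0ℤ ≟ height x y) (n ℕ.* y ℕ.≟ m ℕ.* x)

  aboveFrom-heights : ∀ x y s → 0ℤ ≤ height x y →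
                      aboveFrom m n x y s ≡ does (all? (0ℤ ≤?_) (heights (height x y) s))
  aboveFrom-heights x y []          _   = refl
  aboveFrom-heights x y (true ∷ s)  0≤h = begin
    aboveFrom m n x (suc y) s
      ≡⟨ aboveFrom-heights x (suc y) s 0≤h′ ⟩
    allNonNeg (height x (suc y))
      ≡⟨ cong (_∧ allNonNeg (height x (suc y))) (dec-true (0ℤ ≤? height x (suc y)) 0≤h′) ⟨
    does (0ℤ ≤? height x (suc y)) ∧ allNonNeg (height x (suc y))
      ≡⟨ cong (λ c → does (0ℤ ≤? c) ∧ allNonNeg c) (height-up x y) ⟩
    does (all? (0ℤ ≤?_) (heights (height x y) (true ∷ s))) ∎
    where
    open ≡-Reasoning
    allNonNeg : ℤ → Bool
    allNonNeg c = does (all? (0ℤ ≤?_) (heights c s))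
    0≤h′ : 0ℤ ≤ height x (suc y)
    0≤h′ = subst (0ℤ ≤_) (sym (height-up x y)) (≤-trans 0≤h (i≤i+j (height x y) (+ n)))
  aboveFrom-heights x y (false ∷ s) _   = begin
    (if m ℕ.* suc x ℕ.≤ᵇ n ℕ.* y then aboveFrom m n (suc x) y s else false)
      ≡⟨ cong (λ b → if b then aboveFrom m n (suc x) y s else false) (does-0≤height (suc x) y) ⟨
    (if does (0ℤ ≤? height (suc x) y) then aboveFrom m n (suc x) y s else false)
      ≡⟨ right-step (0ℤ ≤? height (suc x) y) ⟩
    does (0ℤ ≤? height (suc x) y) ∧ allNonNeg (height (suc x) y)
      ≡⟨ cong (λ c → does (0ℤ ≤? c) ∧ allNonNeg c) (height-right x y) ⟩
    does (all? (0ℤ ≤?_) (heights (height x y) (false ∷ s))) ∎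
    where
    open ≡-Reasoning
    allNonNeg : ℤ → Bool
    allNonNeg c = does (all? (0ℤ ≤?_) (heights c s))
    right-step : (d : Dec (0ℤ ≤ height (suc x) y)) →
                 (if does d then aboveFrom m n (suc x) y s else false) ≡ does d ∧ allNonNeg (height (suc x) y)
    right-step (yes 0≤h′) = aboveFrom-heights (suc x) y s 0≤h′
    right-step (no _)     = refl

  anchorsFrom-heights : ∀ x y s → anchorsFrom m n x y s ≡ #zeros (heights (height x y) s)
  anchorsFrom-heights x y []          = refl
  anchorsFrom-heights x y (true ∷ s)  = begin
    (if n ℕ.* suc y ℕ.≡ᵇ m ℕ.* x then 1 else 0) ℕ.+ anchorsFrom m n x (suc y) s
      ≡⟨ cong₂ (λ b k → (if b then 1 else 0) ℕ.+ k)
               (sym (does-0≟height x (suc y))) (anchorsFrom-heights x (suc y) s) ⟩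
    anchorsAt (height x (suc y))                      ≡⟨ cong anchorsAt (height-up x y) ⟩
    anchorsAt (height x y + step true)                ≡⟨ length-filter-∷ (0ℤ ≟_) (height x y + step true) _ ⟨
    #zeros (heights (height x y) (true ∷ s))          ∎
    where
    open ≡-Reasoning
    anchorsAt : ℤ → ℕ
    anchorsAt c = (if does (0ℤ ≟ c) then 1 else 0) ℕ.+ #zeros (heights c s)
  anchorsFrom-heights x y (false ∷ s) = begin
    (if n ℕ.* y ℕ.≡ᵇ m ℕ.* suc x then 1 else 0) ℕ.+ anchorsFrom m n (suc x) y s
      ≡⟨ cong₂ (λ b k → (if b then 1 else 0) ℕ.+ k)
               (sym (does-0≟height (suc x) y)) (anchorsFrom-heights (suc x) y s) ⟩
    anchorsAt (height (suc x) y)                      ≡⟨ cong anchorsAt (height-right x y) ⟩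
    anchorsAt (height x y + step false)               ≡⟨ length-filter-∷ (0ℤ ≟_) (height x y + step false) _ ⟨
    #zeros (heights (height x y) (false ∷ s))         ∎
    where
    open ≡-Reasoning
    anchorsAt : ℤ → ℕ
    anchorsAt c = (if does (0ℤ ≟ c) then 1 else 0) ℕ.+ #zeros (heights c s)

  dyckWeight : Path → ℚ
  dyckWeight p = if isDyck m n p then anchoredWeight m n p else 0ℚ

  dyckWeight-heights : ∀ p → dyckWeight p ≡ profileWeight (gcd m n) (heights 0ℤ p)
  dyckWeight-heights p =
    cong₂ (λ b a → if b then anchoredWeightOf (gcd m n) a else 0ℚ) isDyck-heights anchors-heights
    where
    isDyck-heights : isDyck m n p ≡ does (all? (0ℤ ≤?_) (heights 0ℤ p))
    isDyck-heights = trans (aboveFrom-heights 0 0 p (≤-reflexive (sym height-origin)))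
                           (cong (λ c → does (all? (0ℤ ≤?_) (heights c p))) height-origin)
    anchors-heights : anchors m n p ≡ #zeros (heights 0ℤ p)
    anchors-heights = trans (anchorsFrom-heights 0 0 p) (cong (λ c → #zeros (heights c p)) height-origin)

  recentredWeight : Path → ℤ → ℚ
  recentredWeight w c = profileWeight (gcd m n) (map (_- c) (heights 0ℤ w))

  dyckWeight-rotations : ∀ {w} → level w ≡ 0ℤ → ∀ s t → s ++ t ≡ w →
    map dyckWeight (iterate rotate₁ (t ++ s) (length t)) ≡ map (recentredWeight w) (startLevels (level s) t)
  dyckWeight-rotations level≡0 s []      _ = refl
  dyckWeight-rotations {w} level≡0 s (x ∷ t) s++xt≡w = cong₂ _∷_ rotation-at-s rotations-after-s
    where
    open ≡-Reasoning
    rotation-at-s : dyckWeight ((x ∷ t) ++ s) ≡ recentredWeight w (level s)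
    rotation-at-s = begin
      dyckWeight ((x ∷ t) ++ s)
        ≡⟨ dyckWeight-heights ((x ∷ t) ++ s) ⟩
      profileWeight (gcd m n) (heights 0ℤ ((x ∷ t) ++ s))
        ≡⟨ profileWeight-↭ (gcd m n) (heights-rotate s (x ∷ t) (trans (cong level s++xt≡w) level≡0)) ⟩
      recentredWeight (s ++ x ∷ t) (level s)
        ≡⟨ cong (λ v → recentredWeight v (level s)) s++xt≡w ⟩
      recentredWeight w (level s) ∎
    rotations-after-s : map dyckWeight (iterate rotate₁ ((t ++ s) ∷ʳ x) (length t))
                        ≡ map (recentredWeight w) (startLevels (level s + step x) t)
    rotations-after-s = begin
      map dyckWeight (iterate rotate₁ ((t ++ s) ∷ʳ x) (length t))
        ≡⟨ cong (λ v → map dyckWeight (iterate rotate₁ v (length t))) (++-assoc t s (x ∷ [])) ⟩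
      map dyckWeight (iterate rotate₁ (t ++ (s ∷ʳ x)) (length t))
        ≡⟨ dyckWeight-rotations level≡0 (s ∷ʳ x) t (trans (++-assoc s (x ∷ []) t) s++xt≡w) ⟩
      map (recentredWeight w) (startLevels (level (s ∷ʳ x)) t)
        ≡⟨ cong (λ c → map (recentredWeight w) (startLevels c t))
                (trans (level-++ s (x ∷ [])) (cong (_+_ (level s)) (+-identityʳ (step x)))) ⟩
      map (recentredWeight w) (startLevels (level s + step x) t) ∎

  sum-dyckWeight-rotations : ∀ {w L} → length w ≡ suc L → level w ≡ 0ℤ →
                             sumℚ (map dyckWeight (iterate rotate₁ w (suc L))) ≡ fromℕ (gcd m n)
  sum-dyckWeight-rotations {w@(x ∷ xs)} refl level≡0 = begin
    sumℚ (map dyckWeight (iterate rotate₁ w (length w)))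
      ≡⟨ cong (λ v → sumℚ (map dyckWeight (iterate rotate₁ v (length w)))) (++-identityʳ w) ⟨
    sumℚ (map dyckWeight (iterate rotate₁ (w ++ []) (length w)))
      ≡⟨ cong sumℚ (dyckWeight-rotations level≡0 [] w refl) ⟩
    sumℚ (map (recentredWeight w) (startLevels 0ℤ w))
      ≡⟨ sumℚ-↭ (map⁺ (recentredWeight w) (startLevels-↭ w level≡0)) ⟩
    sumℚ (map (recentredWeight w) (heights 0ℤ w))
      ≡⟨ sum-profileWeight-recentred (gcd m n) (0ℤ + step x) (heights (0ℤ + step x) xs) ⟩
    fromℕ (gcd m n) ∎
    where open ≡-Reasoning

  words-length-level : ∀ a b → All (λ w → length w ≡ a ℕ.+ b × level w ≡ height b a) (words a b)
  words-length-level = words-All (λ a b w → length w ≡ a ℕ.+ b × level w ≡ height b a)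
    (refl , sym height-origin)
    (λ {a} {b} (l , e) → cong suc l ,
       trans (cong (_+_ (step true)) e) (trans (+-comm (step true) (height b a)) (sym (height-up b a))))
    (λ {a} {b} (l , e) → trans (cong suc l) (sym (ℕ.+-suc a b)) ,
       trans (cong (_+_ (step false)) e) (trans (+-comm (step false) (height b a)) (sym (height-right b a))))

  sum-anchoredWeight : ∀ L → m ℕ.+ n ≡ suc L →
    fromℕ (suc L) ℚ.* sumℚ (map (anchoredWeight m n) (dyckPaths m n)) ≡ fromℕ (gcd m n ℕ.* ((m ℕ.+ n) C n))
  sum-anchoredWeight L m+n≡1+L = begin
    fromℕ (suc L) ℚ.* sumℚ (map (anchoredWeight m n) (dyckPaths m n))
      ≡⟨ cong (fromℕ (suc L) ℚ.*_) (sumℚ-filter _ (anchoredWeight m n) (words m n)) ⟩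
    fromℕ (suc L) ℚ.* sumℚ (map dyckWeight (words m n))
      ≡⟨ sumℚ-orbits rotate₁ dyckWeight (map-rotate₁-words m n) (suc L) ⟨
    sumℚ (map (λ w → sumℚ (map dyckWeight (iterate rotate₁ w (suc L)))) (words m n))
      ≡⟨ cong sumℚ (map-cong-local (All.map (λ {w} (l , e) →
           sum-dyckWeight-rotations {w} (trans l m+n≡1+L) (trans e height-end)) (words-length-level m n))) ⟩
    sumℚ (map (λ _ → fromℕ (gcd m n)) (words m n))
      ≡⟨ sumℚ-const (fromℕ (gcd m n)) (words m n) ⟩
    fromℕ (length (words m n)) ℚ.* fromℕ (gcd m n)
      ≡⟨ fromℕ-* (length (words m n)) (gcd m n) ⟨
    fromℕ (length (words m n) ℕ.* gcd m n)
      ≡⟨ cong fromℕ (trans (cong (ℕ._* gcd m n) (length-words m n)) (ℕ.*-comm _ (gcd m n))) ⟩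
    fromℕ (gcd m n ℕ.* ((m ℕ.+ n) C n)) ∎
    where open ≡-Reasoning

theorem1 : (m n : ℕ) → .{{NonZero m}} → .{{NonZero n}} → sumℚ (map (anchoredWeight m n) (dyckPaths m n)) ≡ Cgen m n
theorem1 m@(suc m′) n@(suc _) =
  k*q≡g⇒q≡g/k (m ℕ.+ n) (gcd m n ℕ.* ((m ℕ.+ n) C n)) (sum-anchoredWeight m n (m′ ℕ.+ n) refl)
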